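{- Let $0\le t\le n$ be integers and let $W_n$ be a random lattice path of length $n$ (as described in the context). Then for every integer $k$ with $|k|\le t$ and $k\equiv t\pmod 2$ we have $\mathbb{P}((t,k)\in W_n)=\frac1{t+1}$, and for all other integers $k$ this probability is $0$.
   Context: Random lattice path model: a path $W_n$ of length $n$ starts at $(0,0)$ and uses steps $(1,+1)$ and $(1,-1)$. First an endpoint $(n,D)$ is chosen with $D$ uniformly distributed on $\{ -n,-n+2,\dots,n-2,n\}$; then a path is chosen uniformly at random among all paths from $(0,0)$ to $(n,D)$. $(t,k)\in W_n$ means that the path passes through the point $(t,k)$. -}

module Defs where

open import Data.Bool using (Bool; true; false)
open import Data.Nat using (ℕ; zero; suc)
open import Data.Integer using (ℤ; +_; _+_; _-_; -_)
import Data.Integer as ℤ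
open import Data.List using (List; []; _∷_; _++_; map; filter; length; foldr; upTo)
open import Data.Vec using (Vec; []; _∷_; toList)
open import Data.Rational using (ℚ; _/_; 0ℚ)
import Data.Rational as ℚ
open import Data.Product using (_×_)
open import Relation.Nullary.Decidable using (_×-dec_)
open import Relation.Binary.PropositionalEquality using (_≡_)

-- A lattice path of length n: a vector of n steps; true = (1,+1), false = (1,-1).
Path : ℕ → Set
Path n = Vec Bool n

stepValue : Bool → ℤ
stepValue true  = + 1
stepValue false = - (+ 1)

heightAt : ℕ → List Bool → ℤ
heightAt zero    _        = + 0
heightAt (suc t) []       = + 0
heightAt (suc t) (b ∷ bs) = stepValue b + heightAt t bs

-- (t , k) ∈ W : the path passes through the point (t , k)  (meaningful for t ≤ n)
passesThrough : ∀ {n} → Path n → ℕ → ℤ → Set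
passesThrough p t k = heightAt t (toList p) ≡ k

endpoint : ∀ {n} → Path n → ℤ
endpoint {n} p = heightAt n (toList p)

allPaths : (n : ℕ) → List (Path n)
allPaths zero    = [] ∷ []
allPaths (suc n) = map (true ∷_) (allPaths n) ++ map (false ∷_) (allPaths n)

countTo : (n : ℕ) → ℤ → ℕ
countTo n D = length (filter (λ p → endpoint p ℤ.≟ D) (allPaths n))

countToThrough : (n : ℕ) → ℤ → ℕ → ℤ → ℕ
countToThrough n D t k =
  length (filter (λ p → (endpoint p ℤ.≟ D) ×-dec (heightAt t (toList p) ℤ.≟ k)) (allPaths n))

-- P((t,k) ∈ W_n | endpoint D) for a uniformly random path to (n,D)
-- (the 0 branch is never used for D ∈ {-n,-n+2,…,n}, where there are paths)
condProb : (n : ℕ) → ℤ → ℕ → ℤ → ℚ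
condProb n D t k with countTo n D
... | zero  = 0ℚ
... | suc m = (+ countToThrough n D t k) / suc m

endHeight : ℕ → ℕ → ℤ
endHeight n j = (+ j) + (+ j) - (+ n)

-- P((t,k) ∈ W_n): D uniform on {-n,-n+2,…,n}, then a uniform path to (n,D)
prob : (n : ℕ) → ℕ → ℤ → ℚ
prob n t k =
  foldr ℚ._+_ 0ℚ (map (λ j → ((+ 1) / suc n) ℚ.* condProb n (endHeight n j) t k) (upTo (suc n)))

module Submission where

-- Conditioned on ending after j up-steps, a path has probability 1/((n+1)·C(n,j)) = j!(n−j)!/(n+1)!,
-- so (n+1)!·P((t,k) ∈ W_n) is the sum of ups(p)!·downs(p)! over all paths p through (t,k).
-- Splitting such a path after t steps, the prefix must have a = (t+k)/2 up-steps and b = t−a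
-- down-steps (C(t,a) choices), and the suffix r of length m = n−t contributes (a+ups r)!(b+downs r)!.
-- This suffix sum has the closed form a!·b!·(a+b+m+1)!/(a+b+1)! (a discrete beta integral, by
-- induction on m), so the total is C(t,a)·a!·b!·(n+1)!/(t+1)! = (n+1)!/(t+1).

open import Defs
open import Data.Bool using (true; false)
open import Data.Nat using (ℕ; zero; suc; _+_; _*_; _∸_; _≤_; _<_; _!; s≤s; NonZero)
open import Data.Nat.Properties
open import Algebra.Properties.CommutativeSemigroup +-commutativeSemigroup
  using () renaming (interchange to +-interchange)
open import Data.Nat.Combinatorics using (_C_; nCk≡n!/k![n-k]!; k![n∸k]!∣n!; nCk+nC[k+1]≡[n+1]C[k+1])
open import Data.Nat.DivMod using (m/n*n≡m)
open import Data.Integer using (ℤ; +_; _-_; ∣_∣)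
import Data.Integer as ℤ
import Data.Integer.Properties as ℤ
open import Data.Integer.Divisibility using (_∣_)
open import Data.Nat.Divisibility using (divides)
open import Data.Integer.Tactic.RingSolver using (solve-∀)
import Data.Nat.Tactic.RingSolver as ℕ-Solver
open import Data.List using ([]; _∷_; _++_; map; filter; length; foldr; upTo)
open import Data.List.Properties using (map-++; map-cong; map-∘; upTo-∷ʳ)
open import Data.Nat.ListAction using (sum)
open import Data.Nat.ListAction.Properties using (sum-++)
open import Data.List.Relation.Unary.All using (All; []; _∷_)
open import Data.List.Relation.Unary.All.Properties using (applyUpTo⁺₁)
open import Data.Rational using (ℚ; _/_; 0ℚ)
import Data.Rational as ℚ
import Data.Rational.Properties as ℚ
import Data.Rational.Unnormalised as ℚᵘ
import Data.Rational.Unnormalised.Properties as ℚᵘ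
open import Data.Vec using ([]; _∷_; toList) renaming (_++_ to _++ᵥ_)
open import Data.Product using (_×_; _,_; ∃-syntax)
open import Data.Empty using (⊥-elim)
open import Function using (id; _∘_; _⇔_; mk⇔; Equivalence)
open import Relation.Nullary using (¬_; Dec; yes; no; contradiction)
open import Relation.Nullary.Decidable using (_×-dec_)
open import Relation.Binary.Definitions using (Tri; tri<; tri≈; tri>)
open import Relation.Binary.PropositionalEquality

sum-map-+ : ∀ {A : Set} (f g : A → ℕ) xs →
  sum (map (λ x → f x + g x) xs) ≡ sum (map f xs) + sum (map g xs)
sum-map-+ f g []       = refl
sum-map-+ f g (x ∷ xs) =
  trans (cong (_+_ (f x + g x)) (sum-map-+ f g xs)) (+-interchange (f x) (g x) (sum (map f xs)) (sum (map g xs)))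

sum-map-*ˡ : ∀ {A : Set} c (f : A → ℕ) xs → sum (map (λ x → c * f x) xs) ≡ c * sum (map f xs)
sum-map-*ˡ c f []       = sym (*-zeroʳ c)
sum-map-*ˡ c f (x ∷ xs) = trans (cong (_+_ (c * f x)) (sum-map-*ˡ c f xs)) (sym (*-distribˡ-+ c (f x) _))

sum-map-*ʳ : ∀ {A : Set} (f : A → ℕ) c xs → sum (map (λ x → f x * c) xs) ≡ sum (map f xs) * c
sum-map-*ʳ f c []       = refl
sum-map-*ʳ f c (x ∷ xs) = trans (cong (_+_ (f x * c)) (sum-map-*ʳ f c xs)) (sym (*-distribʳ-+ c (f x) _))

sum-map-zero : ∀ {A : Set} (f : A → ℕ) xs → (∀ x → f x ≡ 0) → sum (map f xs) ≡ 0
sum-map-zero f []       f≡0 = refl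
sum-map-zero f (x ∷ xs) f≡0 = cong₂ _+_ (f≡0 x) (sum-map-zero f xs f≡0)

sum-swap : ∀ {A B : Set} (f : A → B → ℕ) xs ys →
  sum (map (λ x → sum (map (f x) ys)) xs) ≡ sum (map (λ y → sum (map (λ x → f x y) xs)) ys)
sum-swap f []       ys = sym (sum-map-zero _ ys (λ _ → refl))
sum-swap f (x ∷ xs) ys =
  trans (cong (_+_ (sum (map (f x) ys))) (sum-swap f xs ys)) (sym (sum-map-+ (f x) _ ys))

sum-upTo-suc : ∀ (f : ℕ → ℕ) m → sum (map f (upTo (suc m))) ≡ sum (map f (upTo m)) + f m
sum-upTo-suc f m = begin
  sum (map f (upTo (suc m)))             ≡⟨ cong (sum ∘ map f) (upTo-∷ʳ m) ⟨
  sum (map f (upTo m ++ m ∷ []))         ≡⟨ cong sum (map-++ f (upTo m) (m ∷ [])) ⟩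
  sum (map f (upTo m) ++ f m ∷ [])       ≡⟨ sum-++ (map f (upTo m)) (f m ∷ []) ⟩
  sum (map f (upTo m)) + (f m + 0)       ≡⟨ cong (_+_ (sum (map f (upTo m)))) (+-identityʳ (f m)) ⟩
  sum (map f (upTo m)) + f m             ∎
  where open ≡-Reasoning

indicator : ∀ {A : Set} → Dec A → ℕ
indicator (yes _) = 1
indicator (no _)  = 0

indicator-yes : ∀ {A : Set} (a? : Dec A) → A → indicator a? ≡ 1
indicator-yes (yes _) _ = refl
indicator-yes (no ¬a) a = ⊥-elim (¬a a)

indicator-no : ∀ {A : Set} (a? : Dec A) → ¬ A → indicator a? ≡ 0
indicator-no (yes a) ¬a = ⊥-elim (¬a a)
indicator-no (no _)  _  = refl

indicator-cong : ∀ {A B : Set} (a? : Dec A) (b? : Dec B) → A ⇔ B → indicator a? ≡ indicator b?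
indicator-cong a? (yes b) A⇔B = indicator-yes a? (Equivalence.from A⇔B b)
indicator-cong a? (no ¬b) A⇔B = indicator-no a? (¬b ∘ Equivalence.to A⇔B)

indicator-× : ∀ {A B : Set} (a? : Dec A) (b? : Dec B) → indicator (a? ×-dec b?) ≡ indicator a? * indicator b?
indicator-× (yes _) (yes _) = refl
indicator-× (yes _) (no _)  = refl
indicator-× (no _)  _       = refl

indicator-*-cong : ∀ {A : Set} (a? : Dec A) {m n : ℕ} → (A → m ≡ n) → indicator a? * m ≡ indicator a? * n
indicator-*-cong (yes a) m≡n = cong (_*_ 1) (m≡n a)
indicator-*-cong (no _)  _   = refl

length-filter≡sum-indicator : ∀ {A : Set} {P : A → Set} (P? : ∀ x → Dec (P x)) xs →
  length (filter P? xs) ≡ sum (map (indicator ∘ P?) xs)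
length-filter≡sum-indicator P? []       = refl
length-filter≡sum-indicator P? (x ∷ xs) with P? x
... | yes _ = cong suc (length-filter≡sum-indicator P? xs)
... | no _  = length-filter≡sum-indicator P? xs

sum-upTo-indicator : ∀ (g : ℕ → ℕ) u m →
  sum (map (λ j → indicator (u ≟ j) * g j) (upTo m)) ≡ indicator (u <? m) * g u
sum-upTo-indicator g u zero    = refl
sum-upTo-indicator g u (suc m) = begin
  sum (map δ (upTo (suc m)))                          ≡⟨ sum-upTo-suc δ m ⟩
  sum (map δ (upTo m)) + δ m                          ≡⟨ cong (_+ δ m) (sum-upTo-indicator g u m) ⟩
  indicator (u <? m) * g u + indicator (u ≟ m) * g m  ≡⟨ last-term (<-cmp u m) ⟩
  indicator (u <? suc m) * g u                        ∎
  where
  open ≡-Reasoning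
  δ : ℕ → ℕ
  δ j = indicator (u ≟ j) * g j
  last-term : Tri (u < m) (u ≡ m) (m < u) →
    indicator (u <? m) * g u + indicator (u ≟ m) * g m ≡ indicator (u <? suc m) * g u
  last-term (tri< u<m u≢m _)
    rewrite indicator-yes (u <? m) u<m | indicator-no (u ≟ m) u≢m
          | indicator-yes (u <? suc m) (m<n⇒m<1+n u<m) = +-identityʳ _
  last-term (tri≈ u≮u refl _)
    rewrite indicator-no (u <? u) u≮u | indicator-yes (u ≟ u) refl
          | indicator-yes (u <? suc u) (n<1+n u) = refl
  last-term (tri> _ u≢m m<u)
    rewrite indicator-no (u <? m) (<-asym m<u) | indicator-no (u ≟ m) u≢m
          | indicator-no (u <? suc m) (<⇒≱ m<u ∘ ≤-pred) = refl

ups : ∀ {n} → Path n → ℕ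
ups []          = 0
ups (true ∷ p)  = suc (ups p)
ups (false ∷ p) = ups p

downs : ∀ {n} → Path n → ℕ
downs []          = 0
downs (true ∷ p)  = downs p
downs (false ∷ p) = suc (downs p)

ups+downs≡length : ∀ {n} (p : Path n) → ups p + downs p ≡ n
ups+downs≡length []          = refl
ups+downs≡length (true ∷ p)  = cong suc (ups+downs≡length p)
ups+downs≡length (false ∷ p) = trans (+-suc (ups p) (downs p)) (cong suc (ups+downs≡length p))

ups≤length : ∀ {n} (p : Path n) → ups p ≤ n
ups≤length p = subst (ups p ≤_) (ups+downs≡length p) (m≤m+n (ups p) (downs p))

downs≡length∸ups : ∀ {n} (p : Path n) → downs p ≡ n ∸ ups p
downs≡length∸ups p = trans (sym (m+n∸m≡n (ups p) (downs p))) (cong (_∸ ups p) (ups+downs≡length p))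

ups-++ : ∀ {t m} (q : Path t) (r : Path m) → ups (q ++ᵥ r) ≡ ups q + ups r
ups-++ []          r = refl
ups-++ (true ∷ q)  r = cong suc (ups-++ q r)
ups-++ (false ∷ q) r = ups-++ q r

downs-++ : ∀ {t m} (q : Path t) (r : Path m) → downs (q ++ᵥ r) ≡ downs q + downs r
downs-++ []          r = refl
downs-++ (true ∷ q)  r = downs-++ q r
downs-++ (false ∷ q) r = cong suc (downs-++ q r)

heightAt-++ : ∀ {t m} (q : Path t) (r : Path m) → heightAt t (toList (q ++ᵥ r)) ≡ endpoint q
heightAt-++ []      r = refl
heightAt-++ (b ∷ q) r = cong (ℤ._+_ (stepValue b)) (heightAt-++ q r)

endHeight-suc-suc : ∀ n j → endHeight (suc n) (suc j) ≡ + 1 ℤ.+ endHeight n j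
endHeight-suc-suc n j =
  trans (cong₂ (λ x N → (x ℤ.+ x) - N) (ℤ.pos-+ 1 j) (ℤ.pos-+ 1 n)) (shift (+ j) (+ n))
  where
  shift : ∀ x N → ((+ 1 ℤ.+ x) ℤ.+ (+ 1 ℤ.+ x)) - (+ 1 ℤ.+ N) ≡ + 1 ℤ.+ ((x ℤ.+ x) - N)
  shift = solve-∀

endHeight-suc : ∀ n j → endHeight (suc n) j ≡ ℤ.- (+ 1) ℤ.+ endHeight n j
endHeight-suc n j = trans (cong (λ N → (+ j ℤ.+ + j) - N) (ℤ.pos-+ 1 n)) (shift (+ j) (+ n))
  where
  shift : ∀ x N → (x ℤ.+ x) - (+ 1 ℤ.+ N) ≡ ℤ.- (+ 1) ℤ.+ ((x ℤ.+ x) - N)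
  shift = solve-∀

endHeight-injective : ∀ n {i j} → endHeight n i ≡ endHeight n j → i ≡ j
endHeight-injective n {i} {j} eq =
  ℤ.+-injective (ℤ.*-cancelˡ-≡ (+ 2) (+ i) (+ j)
    (trans (double (+ i) (+ n)) (trans (cong (ℤ._+ + n) eq) (sym (double (+ j) (+ n))))))
  where
  double : ∀ x N → + 2 ℤ.* x ≡ ((x ℤ.+ x) - N) ℤ.+ N
  double = solve-∀

endpoint≡endHeight-ups : ∀ {n} (p : Path n) → endpoint p ≡ endHeight n (ups p)
endpoint≡endHeight-ups []                  = refl
endpoint≡endHeight-ups {suc n} (true ∷ p)  =
  trans (cong (ℤ._+_ (+ 1)) (endpoint≡endHeight-ups p)) (sym (endHeight-suc-suc n (ups p)))
endpoint≡endHeight-ups {suc n} (false ∷ p) =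
  trans (cong (ℤ._+_ (ℤ.- (+ 1))) (endpoint≡endHeight-ups p)) (sym (endHeight-suc n (ups p)))

endpoint≡endHeight⇔ups≡ : ∀ {n} (p : Path n) j → endpoint p ≡ endHeight n j ⇔ ups p ≡ j
endpoint≡endHeight⇔ups≡ {n} p j = mk⇔
  (λ eq → endHeight-injective n (trans (sym (endpoint≡endHeight-ups p)) eq))
  (λ { refl → endpoint≡endHeight-ups p })

sum-allPaths-suc : ∀ m (f : Path (suc m) → ℕ) →
  sum (map f (allPaths (suc m)))
  ≡ sum (map (f ∘ (true ∷_)) (allPaths m)) + sum (map (f ∘ (false ∷_)) (allPaths m))
sum-allPaths-suc m f = begin
  sum (map f (map (true ∷_) (allPaths m) ++ map (false ∷_) (allPaths m)))
    ≡⟨ cong sum (map-++ f (map (true ∷_) (allPaths m)) _) ⟩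
  sum (map f (map (true ∷_) (allPaths m)) ++ map f (map (false ∷_) (allPaths m)))
    ≡⟨ sum-++ (map f (map (true ∷_) (allPaths m))) _ ⟩
  sum (map f (map (true ∷_) (allPaths m))) + sum (map f (map (false ∷_) (allPaths m)))
    ≡⟨ cong₂ (λ xs ys → sum xs + sum ys) (map-∘ (allPaths m)) (map-∘ (allPaths m)) ⟨
  sum (map (f ∘ (true ∷_)) (allPaths m)) + sum (map (f ∘ (false ∷_)) (allPaths m)) ∎
  where open ≡-Reasoning

sum-allPaths-++ : ∀ t m (f : Path (t + m) → ℕ) →
  sum (map f (allPaths (t + m))) ≡ sum (map (λ q → sum (map (λ r → f (q ++ᵥ r)) (allPaths m))) (allPaths t))
sum-allPaths-++ zero    m f = sym (+-identityʳ _)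
sum-allPaths-++ (suc t) m f = begin
  sum (map f (allPaths (suc t + m)))
    ≡⟨ sum-allPaths-suc (t + m) f ⟩
  sum (map (f ∘ (true ∷_)) (allPaths (t + m))) + sum (map (f ∘ (false ∷_)) (allPaths (t + m)))
    ≡⟨ cong₂ _+_ (sum-allPaths-++ t m (f ∘ (true ∷_))) (sum-allPaths-++ t m (f ∘ (false ∷_))) ⟩
  sum (map (g ∘ (true ∷_)) (allPaths t)) + sum (map (g ∘ (false ∷_)) (allPaths t))
    ≡⟨ sum-allPaths-suc t g ⟨
  sum (map g (allPaths (suc t))) ∎
  where
  open ≡-Reasoning
  g : Path (suc t) → ℕ
  g q = sum (map (λ r → f (q ++ᵥ r)) (allPaths m))

pathsWithUps : ℕ → ℕ → ℕ
pathsWithUps n j = sum (map (λ p → indicator (ups p ≟ j)) (allPaths n))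

pathsWithUps≡C : ∀ n j → pathsWithUps n j ≡ n C j
pathsWithUps≡C zero    zero    = refl
pathsWithUps≡C zero    (suc j) = refl
pathsWithUps≡C (suc n) zero    = trans (sum-allPaths-suc n (λ p → indicator (ups p ≟ 0)))
  (cong₂ _+_ (sum-map-zero _ (allPaths n) (λ _ → refl)) (pathsWithUps≡C n zero))
pathsWithUps≡C (suc n) (suc j) = begin
  pathsWithUps (suc n) (suc j)
    ≡⟨ sum-allPaths-suc n (λ p → indicator (ups p ≟ suc j)) ⟩
  sum (map (λ p → indicator (suc (ups p) ≟ suc j)) (allPaths n)) + pathsWithUps n (suc j)
    ≡⟨ cong (_+ pathsWithUps n (suc j)) (cong sum (map-cong dropSuc (allPaths n))) ⟩
  pathsWithUps n j + pathsWithUps n (suc j)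
    ≡⟨ cong₂ _+_ (pathsWithUps≡C n j) (pathsWithUps≡C n (suc j)) ⟩
  n C j + n C suc j
    ≡⟨ nCk+nC[k+1]≡[n+1]C[k+1] n j ⟩
  suc n C suc j ∎
  where
  open ≡-Reasoning
  dropSuc : ∀ (p : Path n) → indicator (suc (ups p) ≟ suc j) ≡ indicator (ups p ≟ j)
  dropSuc p = indicator-cong (suc (ups p) ≟ suc j) (ups p ≟ j) (mk⇔ suc-injective (cong suc))

C*factorials≡factorial : ∀ {n k} → k ≤ n → (n C k) * (k ! * (n ∸ k) !) ≡ n !
C*factorials≡factorial {n} {k} k≤n =
  trans (cong (_* (k ! * (n ∸ k) !)) (nCk≡n!/k![n-k]! k≤n)) (m/n*n≡m (k![n∸k]!∣n! k≤n))
  where instance _ = k !* (n ∸ k) !≢0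

factorialWeight : ∀ {m} → ℕ → ℕ → Path m → ℕ
factorialWeight a b r = (a + ups r) ! * (b + downs r) !

weightSum : ℕ → ℕ → ℕ → ℕ
weightSum m a b = sum (map (factorialWeight a b) (allPaths m))

weightSum-suc : ∀ m a b → weightSum (suc m) a b ≡ weightSum m (suc a) b + weightSum m a (suc b)
weightSum-suc m a b = trans (sum-allPaths-suc m (factorialWeight a b))
  (cong₂ _+_ (cong sum (map-cong (λ r → cong (λ x → x ! * (b + downs r) !) (+-suc a (ups r))) (allPaths m)))
             (cong sum (map-cong (λ r → cong (λ y → (a + ups r) ! * y !) (+-suc b (downs r))) (allPaths m))))

-- Each first step raises a or b; the two closed forms add up because (a+1) + (b+1) = a+b+2.
weightSum-closed : ∀ m a b → weightSum m a b * suc (a + b) ! ≡ a ! * b ! * suc (m + (a + b)) !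
weightSum-closed zero a b
  rewrite +-identityʳ a | +-identityʳ b | +-identityʳ (a ! * b !) = refl
weightSum-closed (suc m) a b = *-cancelˡ-≡ _ _ (suc (suc (a + b))) (begin
  suc (suc s) * (weightSum (suc m) a b * suc s !)
    ≡⟨ cong (λ w → suc (suc s) * (w * suc s !)) (weightSum-suc m a b) ⟩
  suc (suc s) * ((weightSum m (suc a) b + weightSum m a (suc b)) * suc s !)
    ≡⟨ spread (suc (suc s)) (weightSum m (suc a) b) (weightSum m a (suc b)) (suc s !) ⟩
  weightSum m (suc a) b * suc (suc s) ! + weightSum m a (suc b) * suc (suc s) !
    ≡⟨ cong₂ _+_ (shifted (suc a) b refl) (shifted a (suc b) (+-suc a b)) ⟩
  suc a ! * b ! * M + a ! * suc b ! * M
    ≡⟨ collect a b (a !) (b !) M ⟩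
  suc (suc s) * (a ! * b ! * M) ∎)
  where
  open ≡-Reasoning
  s = a + b
  M = suc (suc (m + s)) !
  shifted : ∀ a′ b′ → a′ + b′ ≡ suc s → weightSum m a′ b′ * suc (suc s) ! ≡ a′ ! * b′ ! * M
  shifted a′ b′ eq = trans
    (subst (λ x → weightSum m a′ b′ * suc x ! ≡ a′ ! * b′ ! * suc (m + x) !) eq (weightSum-closed m a′ b′))
    (cong (λ x → a′ ! * b′ ! * suc x !) (+-suc m s))
  spread : ∀ c x y z → c * ((x + y) * z) ≡ x * (c * z) + y * (c * z)
  spread = ℕ-Solver.solve-∀
  collect : ∀ a b A B M → (suc a * A) * B * M + A * (suc b * B) * M ≡ suc (suc (a + b)) * (A * B * M)
  collect = ℕ-Solver.solve-∀

passesThrough? : ∀ {n} (p : Path n) t k → Dec (passesThrough p t k)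
passesThrough? p t k = heightAt t (toList p) ℤ.≟ k

throughWeight : ℕ → ℕ → ℤ → ℕ
throughWeight n t k = sum (map (λ p → indicator (passesThrough? p t k) * factorialWeight 0 0 p) (allPaths n))

throughWeight-split : ∀ t m k → throughWeight (t + m) t k
  ≡ sum (map (λ q → indicator (endpoint q ℤ.≟ k) * weightSum m (ups q) (downs q)) (allPaths t))
throughWeight-split t m k =
  trans (sum-allPaths-++ t m _) (cong sum (map-cong throughPrefix (allPaths t)))
  where
  throughPrefix : ∀ q →
    sum (map (λ r → indicator (passesThrough? (q ++ᵥ r) t k) * factorialWeight 0 0 (q ++ᵥ r)) (allPaths m))
    ≡ indicator (endpoint q ℤ.≟ k) * weightSum m (ups q) (downs q)
  throughPrefix q = trans (cong sum (map-cong term (allPaths m)))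
    (sum-map-*ˡ (indicator (endpoint q ℤ.≟ k)) (factorialWeight (ups q) (downs q)) (allPaths m))
    where
    term : ∀ r → indicator (passesThrough? (q ++ᵥ r) t k) * factorialWeight 0 0 (q ++ᵥ r)
               ≡ indicator (endpoint q ℤ.≟ k) * factorialWeight (ups q) (downs q) r
    term r = cong₂ _*_ (cong (λ h → indicator (h ℤ.≟ k)) (heightAt-++ q r))
                       (cong₂ (λ u d → u ! * d !) (ups-++ q r) (downs-++ q r))

throughWeight-unreachable : ∀ t m k → (∀ j → j ≤ t → k ≢ endHeight t j) →
  throughWeight (t + m) t k ≡ 0
throughWeight-unreachable t m k unreachable =
  trans (throughWeight-split t m k) (sum-map-zero _ (allPaths t) missesK)
  where
  missesK : ∀ q → indicator (endpoint q ℤ.≟ k) * weightSum m (ups q) (downs q) ≡ 0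
  missesK q = cong (_* weightSum m (ups q) (downs q)) (indicator-no (endpoint q ℤ.≟ k) λ endpoint≡k →
    unreachable (ups q) (ups≤length q) (trans (sym endpoint≡k) (endpoint≡endHeight-ups q)))

throughWeight-reachable : ∀ t m j → j ≤ t → throughWeight (t + m) t (endHeight t j) * suc t ≡ suc (t + m) !
throughWeight-reachable t m j j≤t = *-cancelʳ-≡ _ _ (t !) {{t !≢0}} (begin
  throughWeight (t + m) t (endHeight t j) * suc t * t !
    ≡⟨ cong (λ w → w * suc t * t !) throughWeight≡C*weightSum ⟩
  (t C j) * W * suc t * t !
    ≡⟨ regroup (t C j) W (suc t) (t !) ⟩
  (t C j) * (W * suc t !)
    ≡⟨ cong (_*_ (t C j)) weightSum-closed′ ⟩
  (t C j) * (j ! * (t ∸ j) ! * suc (m + t) !)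
    ≡⟨ *-assoc (t C j) (j ! * (t ∸ j) !) (suc (m + t) !) ⟨
  (t C j) * (j ! * (t ∸ j) !) * suc (m + t) !
    ≡⟨ cong₂ _*_ (C*factorials≡factorial j≤t) (cong (λ x → suc x !) (+-comm m t)) ⟩
  t ! * suc (t + m) !
    ≡⟨ *-comm (t !) (suc (t + m) !) ⟩
  suc (t + m) ! * t ! ∎)
  where
  open ≡-Reasoning
  W = weightSum m j (t ∸ j)
  weightSum-closed′ : W * suc t ! ≡ j ! * (t ∸ j) ! * suc (m + t) !
  weightSum-closed′ = subst (λ s → W * suc s ! ≡ j ! * (t ∸ j) ! * suc (m + s) !)
    (m+[n∸m]≡n j≤t) (weightSum-closed m j (t ∸ j))
  regroup : ∀ c w x y → c * w * x * y ≡ c * (w * (x * y))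
  regroup = ℕ-Solver.solve-∀
  term : ∀ q → indicator (endpoint q ℤ.≟ endHeight t j) * weightSum m (ups q) (downs q)
             ≡ indicator (ups q ≟ j) * W
  term q = trans
    (cong (_* weightSum m (ups q) (downs q))
      (indicator-cong (endpoint q ℤ.≟ endHeight t j) (ups q ≟ j) (endpoint≡endHeight⇔ups≡ q j)))
    (indicator-*-cong (ups q ≟ j) λ ups≡j →
      cong₂ (weightSum m) ups≡j (trans (downs≡length∸ups q) (cong (t ∸_) ups≡j)))
  throughWeight≡C*weightSum : throughWeight (t + m) t (endHeight t j) ≡ (t C j) * W
  throughWeight≡C*weightSum = begin
    throughWeight (t + m) t (endHeight t j)
      ≡⟨ throughWeight-split t m (endHeight t j) ⟩
    sum (map (λ q → indicator (endpoint q ℤ.≟ endHeight t j) * weightSum m (ups q) (downs q)) (allPaths t))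
      ≡⟨ cong sum (map-cong term (allPaths t)) ⟩
    sum (map (λ q → indicator (ups q ≟ j) * W) (allPaths t))
      ≡⟨ sum-map-*ʳ _ W (allPaths t) ⟩
    pathsWithUps t j * W
      ≡⟨ cong (_* W) (pathsWithUps≡C t j) ⟩
    (t C j) * W ∎

countTo≡C : ∀ n j → countTo n (endHeight n j) ≡ n C j
countTo≡C n j = begin
  countTo n (endHeight n j)
    ≡⟨ length-filter≡sum-indicator (λ p → endpoint p ℤ.≟ endHeight n j) (allPaths n) ⟩
  sum (map (λ p → indicator (endpoint p ℤ.≟ endHeight n j)) (allPaths n))
    ≡⟨ cong sum (map-cong sameEndpoint (allPaths n)) ⟩
  pathsWithUps n j
    ≡⟨ pathsWithUps≡C n j ⟩
  n C j ∎
  where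
  open ≡-Reasoning
  sameEndpoint : ∀ p → indicator (endpoint p ℤ.≟ endHeight n j) ≡ indicator (ups p ≟ j)
  sameEndpoint p = indicator-cong (endpoint p ℤ.≟ endHeight n j) (ups p ≟ j) (endpoint≡endHeight⇔ups≡ p j)

countToThrough≡sum : ∀ n j t k → countToThrough n (endHeight n j) t k
  ≡ sum (map (λ p → indicator (passesThrough? p t k) * indicator (ups p ≟ j)) (allPaths n))
countToThrough≡sum n j t k =
  trans (length-filter≡sum-indicator _ (allPaths n)) (cong sum (map-cong term (allPaths n)))
  where
  term : ∀ p → indicator ((endpoint p ℤ.≟ endHeight n j) ×-dec passesThrough? p t k)
             ≡ indicator (passesThrough? p t k) * indicator (ups p ≟ j)
  term p = begin
    indicator ((endpoint p ℤ.≟ endHeight n j) ×-dec passesThrough? p t k)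
      ≡⟨ indicator-× (endpoint p ℤ.≟ endHeight n j) (passesThrough? p t k) ⟩
    indicator (endpoint p ℤ.≟ endHeight n j) * indicator (passesThrough? p t k)
      ≡⟨ cong (_* indicator (passesThrough? p t k))
           (indicator-cong (endpoint p ℤ.≟ endHeight n j) (ups p ≟ j) (endpoint≡endHeight⇔ups≡ p j)) ⟩
    indicator (ups p ≟ j) * indicator (passesThrough? p t k)
      ≡⟨ *-comm (indicator (ups p ≟ j)) _ ⟩
    indicator (passesThrough? p t k) * indicator (ups p ≟ j) ∎
    where open ≡-Reasoning

sum-countToThrough≡throughWeight : ∀ n t k →
  sum (map (λ j → countToThrough n (endHeight n j) t k * (j ! * (n ∸ j) !)) (upTo (suc n))) ≡ throughWeight n t k
sum-countToThrough≡throughWeight n t k = begin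
  sum (map (λ j → countToThrough n (endHeight n j) t k * g j) (upTo (suc n)))
    ≡⟨ cong sum (map-cong expand (upTo (suc n))) ⟩
  sum (map (λ j → sum (map (λ p → hit j p) (allPaths n))) (upTo (suc n)))
    ≡⟨ sum-swap hit (upTo (suc n)) (allPaths n) ⟩
  sum (map (λ p → sum (map (λ j → hit j p) (upTo (suc n)))) (allPaths n))
    ≡⟨ cong sum (map-cong collapse (allPaths n)) ⟩
  throughWeight n t k ∎
  where
  open ≡-Reasoning
  g : ℕ → ℕ
  g j = j ! * (n ∸ j) !
  hit : ℕ → Path n → ℕ
  hit j p = indicator (passesThrough? p t k) * indicator (ups p ≟ j) * g j
  expand : ∀ j → countToThrough n (endHeight n j) t k * g j ≡ sum (map (λ p → hit j p) (allPaths n))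
  expand j = trans (cong (_* g j) (countToThrough≡sum n j t k)) (sym (sum-map-*ʳ _ (g j) (allPaths n)))
  collapse : ∀ p →
    sum (map (λ j → hit j p) (upTo (suc n))) ≡ indicator (passesThrough? p t k) * factorialWeight 0 0 p
  collapse p = begin
    sum (map (λ j → hit j p) (upTo (suc n)))
      ≡⟨ cong sum (map-cong (λ j → *-assoc (indicator (passesThrough? p t k)) _ (g j)) (upTo (suc n))) ⟩
    sum (map (λ j → indicator (passesThrough? p t k) * (indicator (ups p ≟ j) * g j)) (upTo (suc n)))
      ≡⟨ sum-map-*ˡ (indicator (passesThrough? p t k)) (λ j → indicator (ups p ≟ j) * g j) (upTo (suc n)) ⟩
    indicator (passesThrough? p t k) * sum (map (λ j → indicator (ups p ≟ j) * g j) (upTo (suc n)))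
      ≡⟨ cong (_*_ (indicator (passesThrough? p t k))) (sum-upTo-indicator g (ups p) (suc n)) ⟩
    indicator (passesThrough? p t k) * (indicator (ups p <? suc n) * g (ups p))
      ≡⟨ cong (λ x → indicator (passesThrough? p t k) * (x * g (ups p)))
           (indicator-yes (ups p <? suc n) (s≤s (ups≤length p))) ⟩
    indicator (passesThrough? p t k) * (1 * g (ups p))
      ≡⟨ cong (λ d → indicator (passesThrough? p t k) * (1 * (ups p ! * d !))) (downs≡length∸ups p) ⟨
    indicator (passesThrough? p t k) * (1 * factorialWeight 0 0 p)
      ≡⟨ cong (_*_ (indicator (passesThrough? p t k))) (*-identityˡ (factorialWeight 0 0 p)) ⟩
    indicator (passesThrough? p t k) * factorialWeight 0 0 p ∎

/-cross : ∀ a b m n .{{_ : NonZero m}} .{{_ : NonZero n}} → a * n ≡ b * m → + a / m ≡ + b / n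
/-cross a b (suc m) (suc n) eq = ℚ.fromℚᵘ-cong {ℚᵘ.mkℚᵘ (+ a) m} {ℚᵘ.mkℚᵘ (+ b) n}
  (ℚᵘ.*≡* (trans (sym (ℤ.pos-* a (suc n))) (trans (cong +_ eq) (ℤ.pos-* b (suc m)))))

toℚᵘ-/ : ∀ p n .{{_ : NonZero n}} → ℚ.toℚᵘ (p / n) ℚᵘ.≃ (p ℚᵘ./ n)
toℚᵘ-/ p (suc n) = ℚ.toℚᵘ-fromℚᵘ (ℚᵘ.mkℚᵘ p n)

/-*-/ : ∀ a b m n → (+ a / suc m) ℚ.* (+ b / suc n) ≡ + (a * b) / (suc m * suc n)
/-*-/ a b m n = ℚ.toℚᵘ-injective (ℚᵘ.≃-trans (ℚ.toℚᵘ-homo-* (+ a / suc m) (+ b / suc n))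
  (ℚᵘ.≃-trans (ℚᵘ.*-cong (toℚᵘ-/ (+ a) (suc m)) (toℚᵘ-/ (+ b) (suc n)))
    (ℚᵘ.≃-trans (ℚᵘ.≃-reflexive (cong (ℚᵘ._/ (suc m * suc n)) (sym (ℤ.pos-* a b))))
      (ℚᵘ.≃-sym (toℚᵘ-/ (+ (a * b)) (suc m * suc n))))))

/-+-/ : ∀ a b n .{{_ : NonZero n}} → + a / n ℚ.+ + b / n ≡ + (a + b) / n
/-+-/ a b (suc n) = ℚ.toℚᵘ-injective (ℚᵘ.≃-trans (ℚ.toℚᵘ-homo-+ (+ a / suc n) (+ b / suc n))
  (ℚᵘ.≃-trans (ℚᵘ.+-cong (toℚᵘ-/ (+ a) (suc n)) (toℚᵘ-/ (+ b) (suc n)))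
    (ℚᵘ.≃-trans (ℚᵘ.*≡* commonDenominator) (ℚᵘ.≃-sym (toℚᵘ-/ (+ (a + b)) (suc n))))))
  where
  factorOut : ∀ x y d → (x ℤ.* d ℤ.+ y ℤ.* d) ℤ.* d ≡ (x ℤ.+ y) ℤ.* (d ℤ.* d)
  factorOut = solve-∀
  commonDenominator : (+ a ℤ.* + suc n ℤ.+ + b ℤ.* + suc n) ℤ.* + suc n ≡ + (a + b) ℤ.* + (suc n * suc n)
  commonDenominator = trans (factorOut (+ a) (+ b) (+ suc n))
    (sym (cong₂ ℤ._*_ (ℤ.pos-+ a b) (ℤ.pos-* (suc n) (suc n))))

foldr-+-/ : ∀ {A : Set} (h : A → ℚ) (x : A → ℕ) n .{{_ : NonZero n}} xs →
  All (λ a → h a ≡ + x a / n) xs → foldr ℚ._+_ 0ℚ (map h xs) ≡ + sum (map x xs) / n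
foldr-+-/ h x n []       []           = sym (ℚ.0/n≡0 n)
foldr-+-/ h x n (a ∷ xs) (ha≡ ∷ hxs≡) =
  trans (cong₂ ℚ._+_ ha≡ (foldr-+-/ h x n xs hxs≡)) (/-+-/ (x a) (sum (map x xs)) n)

condProb-scaled : ∀ n D t k g → countTo n D * g ≡ n ! →
  (+ 1 / suc n) ℚ.* condProb n D t k ≡ (+ (countToThrough n D t k * g) / suc n !) {{suc n !≢0}}
condProb-scaled n D t k g countTo*g≡n! with countTo n D
... | zero  = contradiction (subst (1 ≤_) (sym countTo*g≡n!) (1≤n! n)) λ ()
... | suc c =
  trans (/-*-/ 1 T n c) (/-cross (1 * T) (T * g) (suc n * suc c) (suc n !) ⦃ _ ⦄ ⦃ suc n !≢0 ⦄ cross)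
  where
  T = countToThrough n D t k
  rearrange : ∀ T g n c → 1 * T * (n * (c * g)) ≡ T * g * (n * c)
  rearrange = ℕ-Solver.solve-∀
  cross : 1 * T * suc n ! ≡ T * g * (suc n * suc c)
  cross = trans (cong (λ f → 1 * T * (suc n * f)) (sym countTo*g≡n!)) (rearrange T g (suc n) (suc c))

prob≡throughWeight/ : ∀ n t k → prob n t k ≡ (+ throughWeight n t k / suc n !) {{suc n !≢0}}
prob≡throughWeight/ n t k = trans
  (foldr-+-/ _ (λ j → countToThrough n (endHeight n j) t k * g j) (suc n !) ⦃ suc n !≢0 ⦄ (upTo (suc n))
    (applyUpTo⁺₁ id (suc n) λ {j} j<1+n →
      condProb-scaled n (endHeight n j) t k (g j) (countTo*g≡n! j (≤-pred j<1+n))))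
  (cong (λ w → (+ w / suc n !) ⦃ suc n !≢0 ⦄) (sum-countToThrough≡throughWeight n t k))
  where
  g : ℕ → ℕ
  g j = j ! * (n ∸ j) !
  countTo*g≡n! : ∀ j → j ≤ n → countTo n (endHeight n j) * g j ≡ n !
  countTo*g≡n! j j≤n = trans (cong (_* g j) (countTo≡C n j)) (C*factorials≡factorial j≤n)

Reachable : ℕ → ℤ → Set
Reachable t k = ∣ k ∣ ≤ t × (+ 2) ∣ (k - + t)

pos-split : ∀ {t j} → j ≤ t → + t ≡ + j ℤ.+ + (t ∸ j)
pos-split {t} {j} j≤t = trans (cong +_ (sym (m+[n∸m]≡n j≤t))) (ℤ.pos-+ j (t ∸ j))

∣i∣≤n⇒i≤n : ∀ {i n} → ∣ i ∣ ≤ n → i ℤ.≤ + n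
∣i∣≤n⇒i≤n {+ _}      ∣i∣≤n = ℤ.+≤+ ∣i∣≤n
∣i∣≤n⇒i≤n {ℤ.-[1+ _ ]} _   = ℤ.-≤+

endHeight≡ups-downs : ∀ {t j} → j ≤ t → endHeight t j ≡ + j - + (t ∸ j)
endHeight≡ups-downs {t} {j} j≤t =
  trans (cong (λ T → (+ j ℤ.+ + j) - T) (pos-split j≤t)) (cancel (+ j) (+ (t ∸ j)))
  where
  cancel : ∀ x y → (x ℤ.+ x) - (x ℤ.+ y) ≡ x - y
  cancel = solve-∀

endHeight-reachable : ∀ {t j} → j ≤ t → Reachable t (endHeight t j)
endHeight-reachable {t} {j} j≤t = subst (Reachable t) (sym (endHeight≡ups-downs j≤t)) (bounded , even)
  where
  b = t ∸ j
  bounded : ∣ + j - + b ∣ ≤ t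
  bounded = subst (∣ + j - + b ∣ ≤_) (m+[n∸m]≡n j≤t) (ℤ.∣i-j∣≤∣i∣+∣j∣ (+ j) (+ b))
  twiceDowns : ∀ x y → (x - y) - (x ℤ.+ y) ≡ ℤ.- (y ℤ.* + 2)
  twiceDowns = solve-∀
  diff≡-2b : (+ j - + b) - + t ≡ ℤ.- (+ (b * 2))
  diff≡-2b = trans (cong (λ T → (+ j - + b) - T) (pos-split j≤t))
    (trans (twiceDowns (+ j) (+ b)) (cong ℤ.-_ (sym (ℤ.pos-* b 2))))
  even : (+ 2) ∣ ((+ j - + b) - + t)
  even = divides b (trans (cong ∣_∣ diff≡-2b) (ℤ.∣-i∣≡∣i∣ (+ (b * 2))))

reachable⇒endHeight : ∀ {t k} → Reachable t k → ∃[ j ] j ≤ t × k ≡ endHeight t j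
reachable⇒endHeight {t} {k} (∣k∣≤t , divides q ∣k-t∣≡q*2) = t ∸ q , m∸n≤m t q , k≡endHeight
  where
  q*2≤t*2 : q * 2 ≤ t * 2
  q*2≤t*2 = begin
    q * 2               ≡⟨ ∣k-t∣≡q*2 ⟨
    ∣ k - + t ∣         ≤⟨ ℤ.∣i-j∣≤∣i∣+∣j∣ k (+ t) ⟩
    ∣ k ∣ + t           ≤⟨ +-monoˡ-≤ t ∣k∣≤t ⟩
    t + t               ≡⟨ cong (_+_ t) (+-identityʳ t) ⟨
    2 * t               ≡⟨ *-comm 2 t ⟩
    t * 2               ∎
    where open ≤-Reasoning
  q≤t : q ≤ t
  q≤t = *-cancelʳ-≤ q t 2 q*2≤t*2
  t-k≡q*2 : + t - k ≡ + (q * 2)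
  t-k≡q*2 = trans (sym (ℤ.∣-∣-≤ (∣i∣≤n⇒i≤n {k} ∣k∣≤t))) (cong +_ ∣k-t∣≡q*2)
  k≡t-[t-k] : ∀ k T → k ≡ T - (T - k)
  k≡t-[t-k] = solve-∀
  removeUps : ∀ x y → (x ℤ.+ y) - (x ℤ.* + 2) ≡ y - x
  removeUps = solve-∀
  k≡endHeight : k ≡ endHeight t (t ∸ q)
  k≡endHeight = begin
    k                                 ≡⟨ k≡t-[t-k] k (+ t) ⟩
    + t - (+ t - k)                   ≡⟨ cong₂ _-_ (pos-split q≤t) (trans t-k≡q*2 (ℤ.pos-* q 2)) ⟩
    (+ q ℤ.+ + (t ∸ q)) - + q ℤ.* + 2 ≡⟨ removeUps (+ q) (+ (t ∸ q)) ⟩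
    + (t ∸ q) - + q                   ≡⟨ cong (λ b → + (t ∸ q) - + b) (m∸[m∸n]≡n q≤t) ⟨
    + (t ∸ q) - + (t ∸ (t ∸ q))       ≡⟨ endHeight≡ups-downs (m∸n≤m t q) ⟨
    endHeight t (t ∸ q)               ∎
    where open ≡-Reasoning

prob-reachable : ∀ t m j → j ≤ t → prob (t + m) t (endHeight t j) ≡ + 1 / suc t
prob-reachable t m j j≤t = trans (prob≡throughWeight/ (t + m) t (endHeight t j))
  (/-cross (throughWeight (t + m) t (endHeight t j)) 1 (suc (t + m) !) (suc t) ⦃ suc (t + m) !≢0 ⦄
    (trans (throughWeight-reachable t m j j≤t) (sym (*-identityˡ _))))

prob-unreachable : ∀ t m k → ¬ Reachable t k → prob (t + m) t k ≡ 0ℚ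
prob-unreachable t m k unreachable = begin
  prob (t + m) t k
    ≡⟨ prob≡throughWeight/ (t + m) t k ⟩
  (+ throughWeight (t + m) t k / suc (t + m) !) ⦃ suc (t + m) !≢0 ⦄
    ≡⟨ cong (λ w → (+ w / suc (t + m) !) ⦃ suc (t + m) !≢0 ⦄) (throughWeight-unreachable t m k missesK) ⟩
  (+ 0 / suc (t + m) !) ⦃ suc (t + m) !≢0 ⦄
    ≡⟨ ℚ.0/n≡0 (suc (t + m) !) ⦃ suc (t + m) !≢0 ⦄ ⟩
  0ℚ ∎
  where
  open ≡-Reasoning
  missesK : ∀ j → j ≤ t → k ≢ endHeight t j
  missesK j j≤t k≡ = unreachable (subst (Reachable t) (sym k≡) (endHeight-reachable j≤t))

lemma6p3 : (n t : ℕ) → t ≤ n → (k : ℤ) →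
    ((∣ k ∣ ≤ t × (+ 2) ∣ (k - + t)) → prob n t k ≡ (+ 1) / suc t)
    × (¬ (∣ k ∣ ≤ t × (+ 2) ∣ (k - + t)) → prob n t k ≡ 0ℚ)
lemma6p3 n t t≤n k with m≤n⇒∃[o]m+o≡n t≤n
... | m , refl = reachable , prob-unreachable t m k
  where
  reachable : Reachable t k → prob (t + m) t k ≡ + 1 / suc t
  reachable k-reachable with j , j≤t , k≡ ← reachable⇒endHeight k-reachable =
    trans (cong (prob (t + m) t) k≡) (prob-reachable t m j j≤t)
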